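{- Let $r\ge0$ be an integer. The number of finite lists $(B_1,\dots,B_\ell)$, $\ell\ge0$, of elements of $\mathcal{B}$ with a total of $r+\ell$ vertices (i.e. $\sum_{i=1}^\ell(|B_i|-1)=r$, where $|B_i|$ is the number of vertices of $B_i$) is $\binom{2r}{r}$. For an integer $r_2\ge0$, the number of such lists containing in total exactly $r_2$ oriented 3-cycles is $$2^{r-2r_2}\binom{r}{r_2,\,r_2,\,r-2r_2}=2^{r-2r_2}\binom{r}{2r_2}\binom{2r_2}{r_2}.$$
   Context: Multinomial and binomial coefficients with a negative lower entry are $0$. Quivers are finite, without loops and without oriented 2-cycles. A rooted quiver of type $A$ is a quiver with a distinguished vertex (the root), defined recursively (up to root-preserving isomorphism) as one of: (i) a single vertex, the root; (ii) a root $\rho$, a rooted quiver of type $A$ with root $v\ne\rho$, and one arrow between $\rho$ and $v$ (either direction); (iii) a root $\rho$, an oriented 3-cycle $\rho\to u\to w\to\rho$, and two vertex-disjoint rooted quivers of type $A$ with roots $u$ and $w$. $\mathcal{B}$ is the set of the following quivers with two distinguished vertices, a left vertex $a$ and a right vertex $b$ (up to isomorphisms preserving $a$ and $b$), joined by a "base arrow": (1) a single arrow $a\to b$; (2) an arrow $a\to b$ together with a vertex $z$ and arrows $b\to z\to a$ (an oriented 3-cycle) and a rooted quiver of type $A$ with root $z$; (3) a single arrow $b\to a$; (4) an arrow $b\to a$ together with a vertex $z$ and arrows $a\to z\to b$ and a rooted quiver of type $A$ with root $z$. -}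

module Defs where

open import Data.Nat.Base using (ℕ; zero; suc; _+_; _*_; _∸_; _!; _/_; _≤ᵇ_; NonZero)
open import Data.Nat.Properties using (_!≢0; m*n≢0)
open import Data.Bool.Base using (if_then_else_)
open import Data.List.Base using (List; []; _∷_)

-- Rooted quivers of type A, up to root-preserving isomorphism.
-- One constructor per clause of the recursive definition:
--   single         : (i)   a single vertex, the root
--   ext d Q        : (ii)  new root ρ, arrow between ρ and the root v of Q,
--                          direction d (ρ→v or v→ρ)
--   tri Qu Qw      : (iii) new root ρ, oriented 3-cycle ρ→u→w→ρ, with Qu
--                          rooted at u and Qw rooted at w
-- (Distinct terms give non-isomorphic rooted quivers and every rooted
--  quiver of type A arises, since the clause and its data are recovered
--  canonically from the root.)

data ArrowDir : Set where
  fromRoot : ArrowDir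
  toRoot   : ArrowDir

data RootedA : Set where
  single : RootedA
  ext    : ArrowDir → RootedA → RootedA
  tri    : RootedA → RootedA → RootedA

verticesA : RootedA → ℕ
verticesA single      = 1
verticesA (ext _ q)   = suc (verticesA q)
verticesA (tri q q′)  = suc (verticesA q + verticesA q′)

cyclesA : RootedA → ℕ
cyclesA single      = 0
cyclesA (ext _ q)   = cyclesA q
cyclesA (tri q q′)  = suc (cyclesA q + cyclesA q′)

-- The set 𝓑 (quivers with left vertex a, right vertex b, base arrow).

data 𝓑 : Set where
  b₁ : 𝓑              -- (1) a → b
  b₂ : RootedA → 𝓑    -- (2) a → b, b → z → a, rooted type A quiver at z
  b₃ : 𝓑              -- (3) b → a
  b₄ : RootedA → 𝓑    -- (4) b → a, a → z → b, rooted type A quiver at z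

verticesB : 𝓑 → ℕ
verticesB b₁     = 2
verticesB (b₂ q) = 2 + verticesA q
verticesB b₃     = 2
verticesB (b₄ q) = 2 + verticesA q

cyclesB : 𝓑 → ℕ
cyclesB b₁     = 0
cyclesB (b₂ q) = suc (cyclesA q)
cyclesB b₃     = 0
cyclesB (b₄ q) = suc (cyclesA q)

excess : List 𝓑 → ℕ
excess []       = 0
excess (B ∷ Bs) = (verticesB B ∸ 1) + excess Bs

totalCycles : List 𝓑 → ℕ
totalCycles []       = 0
totalCycles (B ∷ Bs) = cyclesB B + totalCycles Bs

-- Multinomial coefficient  (n ; a , b , n - a - b),  which is 0 when the
-- last lower entry n - a - b is negative (i.e. a + b > n).

multinomial3 : ℕ → ℕ → ℕ → ℕ
multinomial3 n a b =
  if (a + b) ≤ᵇ n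
  then n ! / (a ! * b ! * (n ∸ (a + b)) !)
  else 0
  where
  instance
    _ : NonZero (a ! * b ! * (n ∸ (a + b)) !)
    _ = m*n≢0 (a ! * b !) ((n ∸ (a + b)) !)
          {{m*n≢0 (a !) (b !) {{a !≢0}} {{b !≢0}}}} {{(n ∸ (a + b)) !≢0}}

-- A rooted quiver of type A is read as a Motzkin word: the arrow from a new root to the old one
-- is a flat step coloured by its direction, and an oriented 3-cycle ρ → u → w → ρ is a rise,
-- the word of u, a fall, and the word of w.  An element of 𝓑 of type (1) or (3) becomes one flat
-- step, and one of type (2) or (4) an excursion above, respectively below, the axis around the
-- word of its quiver at z.  Concatenation is then a bijection from lists of 𝓑 onto words over
-- {flat fromRoot, flat toRoot, up, down} with as many ups as downs, taking Σ (|Bᵢ| - 1) to the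
-- length and the number of oriented 3-cycles to the number of ups.  Writing the four letters as
-- the bit pairs 10, 01, 11, 00 identifies balanced words of length r with bit strings of length
-- 2r with r ones, whence (2r choose r).  A word with c ups and c downs is determined by the
-- positions of its 2c steps, which c of them rise, and the colours of its r - 2c flat steps,
-- whence (r choose 2c) (2c choose c) 2^(r - 2c).

module Submission where

open import Defs
open import Data.Bool.Base using (Bool; true; false)
open import Data.Bool.Properties using (if-cong; T-≡)
open import Data.Fin.Base using (Fin)
open import Data.Fin.Patterns using (0F; 1F)
open import Data.Fin.Properties using (0↔⊥; 1↔⊤; +↔⊎; *↔×)
open import Data.List.Base using (List; []; _∷_; length)
open import Data.Nat.Base using (ℕ; zero; suc; _+_; _*_; _∸_; _^_; _!; _/_; _≤_; _≤ᵇ_; z≤n; s≤s)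
open import Data.Nat.Combinatorics
  using (_C_; nCk≡n!/k![n-k]!; k![n∸k]!∣n!; k>n⇒nCk≡0; nCk+nC[k+1]≡[n+1]C[k+1])
open import Data.Nat.DivMod using (m/n*n≡m; m*n/n≡m; /-congˡ)
open import Data.Nat.Properties
  using (suc-injective; ≡-irrelevant; 0≢1+n; _≤?_; ≰⇒>; ≤ᵇ-reflects-≤; ≤⇒≤ᵇ; m≤m+n; m≤n⇒m≤1+n;
         +-comm; +-assoc; +-suc; +-identityʳ; +-cancelˡ-≡; +-cancelʳ-≡; +-∸-assoc; m+n∸m≡n;
         *-comm; *-assoc; *-cancelˡ-≡; m*n≢0; _!≢0; _!*_!≢0)
open import Data.Product.Base using (Σ; _×_; _,_; proj₁; proj₂)
open import Data.Product.Function.NonDependent.Propositional using (_×-↔_)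
open import Data.Sum.Base using (_⊎_; inj₁; inj₂)
open import Data.Sum.Function.Propositional using (_⊎-↔_)
open import Data.Vec.Base using (Vec; []; _∷_; replicate)
open import Function.Bundles using (_↔_; mk↔ₛ′; Equivalence)
open import Function.Properties.Inverse using (↔-sym; ↔-refl; ↔-trans)
open import Function.Related.Propositional using (module EquationalReasoning)
open import Relation.Binary.PropositionalEquality
open import Relation.Nullary.Decidable.Core using (yes; no)
open import Relation.Nullary.Irrelevant using (Irrelevant)
open import Relation.Nullary.Negation.Core using (contradiction)
open import Relation.Nullary.Reflects using (ofʸ)

×-irrelevant : ∀ {A B : Set} → Irrelevant A → Irrelevant B → Irrelevant (A × B)
×-irrelevant irrA irrB (a , b) (a′ , b′) = cong₂ _,_ (irrA a a′) (irrB b b′)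

Σ-≡ : ∀ {A : Set} {P : A → Set} → (∀ {a} → Irrelevant (P a)) →
      ∀ {a b} {p : P a} {q : P b} → a ≡ b → (a , p) ≡ (b , q)
Σ-≡ irr {p = p} {q} refl = cong (_ ,_) (irr p q)

subtype-↔ : ∀ {A B : Set} {P : A → Set} {Q : B → Set} →
            (∀ {a} → Irrelevant (P a)) → (∀ {b} → Irrelevant (Q b)) →
            (f : A → B) (g : B → A) →
            (∀ a → P a → Q (f a)) → (∀ b → Q b → P (g b)) →
            (∀ a → P a → g (f a) ≡ a) → (∀ b → Q b → f (g b) ≡ b) →
            Σ A P ↔ Σ B Q
subtype-↔ irrP irrQ f g f-resp g-resp g∘f f∘g = mk↔ₛ′
  (λ (a , p) → f a , f-resp a p) (λ (b , q) → g b , g-resp b q)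
  (λ (b , q) → Σ-≡ irrQ (f∘g b q)) (λ (a , p) → Σ-≡ irrP (g∘f a p))

≡⇒Fin↔ : ∀ {m n} → m ≡ n → Fin m ↔ Fin n
≡⇒Fin↔ refl = ↔-refl

Σ-×↔×-Σ : ∀ {A B : Set} {P : A → Set} {Q : B → Set} →
          Σ (A × B) (λ (a , b) → P a × Q b) ↔ (Σ A P × Σ B Q)
Σ-×↔×-Σ = mk↔ₛ′ (λ ((a , b) , p , q) → (a , p) , (b , q)) (λ ((a , p) , (b , q)) → (a , b) , p , q)
                (λ _ → refl) (λ _ → refl)

Tuples : Set → ℕ → Set
Tuples A n = Σ (List A) (λ xs → length xs ≡ n)

Tuples-suc↔ : ∀ {A : Set} n → Tuples A (suc n) ↔ (A × Tuples A n)
Tuples-suc↔ n = mk↔ₛ′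
  (λ { (x ∷ xs , e) → x , xs , suc-injective e }) (λ (x , xs , e) → x ∷ xs , cong suc e)
  (λ { (x , xs , refl) → refl }) (λ { (x ∷ xs , e) → Σ-≡ ≡-irrelevant refl })

Tuples↔Fin^ : ∀ {A : Set} {k} → A ↔ Fin k → ∀ n → Tuples A n ↔ Fin (k ^ n)
Tuples↔Fin^ A↔k zero =
  ↔-trans (mk↔ₛ′ _ (λ _ → [] , refl) (λ _ → refl) (λ { ([] , refl) → refl })) (↔-sym 1↔⊤)
Tuples↔Fin^ {A} {k} A↔k (suc n) = begin
  Tuples A (suc n)        ↔⟨ Tuples-suc↔ n ⟩
  (A × Tuples A n)        ↔⟨ A↔k ×-↔ Tuples↔Fin^ A↔k n ⟩
  (Fin k × Fin (k ^ n))   ↔⟨ *↔× {k} {k ^ n} ⟨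
  Fin (k ^ suc n)         ∎
  where open EquationalReasoning

trues : List Bool → ℕ
trues []           = 0
trues (true ∷ bs)  = suc (trues bs)
trues (false ∷ bs) = trues bs

IsBitString : ℕ → ℕ → List Bool → Set
IsBitString n k bs = length bs ≡ n × trues bs ≡ k

BitString : ℕ → ℕ → Set
BitString n k = Σ (List Bool) (IsBitString n k)

BitString-≡ : ∀ {n k} {x y : BitString n k} → proj₁ x ≡ proj₁ y → x ≡ y
BitString-≡ = Σ-≡ (×-irrelevant ≡-irrelevant ≡-irrelevant)

BitString-suc-zero↔ : ∀ n → BitString (suc n) 0 ↔ BitString n 0
BitString-suc-zero↔ n = mk↔ₛ′
  (λ { (false ∷ bs , l , t) → bs , suc-injective l , t ; (true ∷ _ , _ , ()) })
  (λ (bs , l , t) → false ∷ bs , cong suc l , t)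
  (λ _ → BitString-≡ refl) (λ { (false ∷ _ , _) → BitString-≡ refl ; (true ∷ _ , _ , ()) })

BitString-suc-suc↔ : ∀ n k → BitString (suc n) (suc k) ↔ (BitString n (suc k) ⊎ BitString n k)
BitString-suc-suc↔ n k = mk↔ₛ′ split join
  (λ { (inj₁ _) → cong inj₁ (BitString-≡ refl) ; (inj₂ _) → cong inj₂ (BitString-≡ refl) })
  (λ { (false ∷ _ , _) → BitString-≡ refl ; (true ∷ _ , _) → BitString-≡ refl })
  where
  split : BitString (suc n) (suc k) → BitString n (suc k) ⊎ BitString n k
  split (false ∷ bs , l , t) = inj₁ (bs , suc-injective l , t)
  split (true ∷ bs , l , t)  = inj₂ (bs , suc-injective l , suc-injective t)
  join : BitString n (suc k) ⊎ BitString n k → BitString (suc n) (suc k)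
  join (inj₁ (bs , l , t)) = false ∷ bs , cong suc l , t
  join (inj₂ (bs , l , t)) = true ∷ bs , cong suc l , cong suc t

BitString↔Fin-C : ∀ n k → BitString n k ↔ Fin (n C k)
BitString↔Fin-C zero zero =
  ↔-trans (mk↔ₛ′ _ (λ _ → [] , refl , refl) (λ _ → refl) (λ { ([] , refl , refl) → refl })) (↔-sym 1↔⊤)
BitString↔Fin-C zero (suc k) =
  ↔-trans (mk↔ₛ′ (λ { ([] , _ , ()) }) (λ ()) (λ ()) (λ { ([] , _ , ()) })) (↔-sym 0↔⊥)
BitString↔Fin-C (suc n) zero = ↔-trans (BitString-suc-zero↔ n) (BitString↔Fin-C n zero)
BitString↔Fin-C (suc n) (suc k) = begin
  BitString (suc n) (suc k)                 ↔⟨ BitString-suc-suc↔ n k ⟩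
  (BitString n (suc k) ⊎ BitString n k)     ↔⟨ BitString↔Fin-C n (suc k) ⊎-↔ BitString↔Fin-C n k ⟩
  (Fin (n C suc k) ⊎ Fin (n C k))           ↔⟨ +↔⊎ ⟨
  Fin (n C suc k + n C k)                   ↔⟨ ≡⇒Fin↔ (trans (+-comm (n C suc k) (n C k)) (nCk+nC[k+1]≡[n+1]C[k+1] n k)) ⟩
  Fin (suc n C suc k)                       ∎
  where open EquationalReasoning

falses : List Bool → ℕ
falses []           = 0
falses (true ∷ bs)  = falses bs
falses (false ∷ bs) = suc (falses bs)

falses≡length∸trues : ∀ bs → falses bs ≡ length bs ∸ trues bs
falses≡length∸trues []           = refl
falses≡length∸trues (true ∷ bs)  = falses≡length∸trues bs
falses≡length∸trues (false ∷ bs) =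
  trans (cong suc (falses≡length∸trues bs)) (sym (+-∸-assoc 1 (trues≤length bs)))
  where
  trues≤length : ∀ bs → trues bs ≤ length bs
  trues≤length []           = z≤n
  trues≤length (true ∷ bs)  = s≤s (trues≤length bs)
  trues≤length (false ∷ bs) = m≤n⇒m≤1+n (trues≤length bs)

2*n≡n+n : ∀ n → 2 * n ≡ n + n
2*n≡n+n n = cong (n +_) (+-identityʳ n)

m+m≡n+n⇒m≡n : ∀ {m n} → m + m ≡ n + n → m ≡ n
m+m≡n+n⇒m≡n {m} {n} e = *-cancelˡ-≡ m n 2 (trans (2*n≡n+n m) (trans e (sym (2*n≡n+n n))))

factorial-split : ∀ {n k} → k ≤ n → n ! ≡ (n C k) * (k ! * (n ∸ k) !)
factorial-split {n} {k} k≤n = begin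
  n !                                          ≡⟨ m/n*n≡m (k![n∸k]!∣n! k≤n) ⟨
  n ! / (k ! * (n ∸ k) !) * (k ! * (n ∸ k) !)  ≡⟨ cong (_* (k ! * (n ∸ k) !)) (nCk≡n!/k![n-k]! k≤n) ⟨
  (n C k) * (k ! * (n ∸ k) !)                  ∎
  where
  open ≡-Reasoning
  instance _ = k !* (n ∸ k) !≢0

multinomial3≡C*C : ∀ n a b → multinomial3 n a b ≡ (n C (a + b)) * ((a + b) C a)
multinomial3≡C*C n a b with a + b ≤? n
... | no a+b≰n = begin
  multinomial3 n a b            ≡⟨ vanishes ⟩
  0                             ≡⟨ cong (_* ((a + b) C a)) (k>n⇒nCk≡0 (≰⇒> a+b≰n)) ⟨
  (n C (a + b)) * ((a + b) C a) ∎
  where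
  open ≡-Reasoning
  vanishes : multinomial3 n a b ≡ 0
  vanishes with (a + b) ≤ᵇ n | ≤ᵇ-reflects-≤ (a + b) n
  ... | true  | ofʸ a+b≤n = contradiction a+b≤n a+b≰n
  ... | false | _         = refl
... | yes a+b≤n = begin
  multinomial3 n a b  ≡⟨ if-cong (Equivalence.to T-≡ (≤⇒≤ᵇ a+b≤n)) ⟩
  n ! / d             ≡⟨ /-congˡ n!≡X*Y*d ⟩
  X * Y * d / d       ≡⟨ m*n/n≡m (X * Y) d ⟩
  X * Y               ∎
  where
  open ≡-Reasoning
  X = n C (a + b)
  Y = (a + b) C a
  l = n ∸ (a + b)
  d = a ! * b ! * l !
  instance _ = m*n≢0 (a ! * b !) (l !) {{a !* b !≢0}} {{l !≢0}}
  n!≡X*Y*d : n ! ≡ X * Y * d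
  n!≡X*Y*d = begin
    n !                                   ≡⟨ factorial-split a+b≤n ⟩
    X * ((a + b) ! * l !)                 ≡⟨ cong (λ f → X * (f * l !)) (factorial-split (m≤m+n a b)) ⟩
    X * (Y * (a ! * (a + b ∸ a) !) * l !) ≡⟨ cong (λ m → X * (Y * (a ! * m !) * l !)) (m+n∸m≡n a b) ⟩
    X * (Y * (a ! * b !) * l !)           ≡⟨ cong (X *_) (*-assoc Y (a ! * b !) (l !)) ⟩
    X * (Y * d)                           ≡⟨ *-assoc X Y d ⟨
    X * Y * d                             ∎

data Dir : Set where
  up down : Dir

opposite : Dir → Dir
opposite up   = down
opposite down = up

data Letter : Set where
  flat : ArrowDir → Letter
  step : Dir → Letter

Word : Set
Word = List Letter

steps : Dir → Word → ℕ
steps v    []               = 0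
steps v    (flat _ ∷ w)     = steps v w
steps up   (step up ∷ w)    = suc (steps up w)
steps up   (step down ∷ w)  = steps up w
steps down (step up ∷ w)    = steps down w
steps down (step down ∷ w)  = suc (steps down w)

Balanced : Word → Set
Balanced w = steps up w ≡ steps down w

steps-same : ∀ v w → steps v (step v ∷ w) ≡ suc (steps v w)
steps-same up   w = refl
steps-same down w = refl

steps-opposite : ∀ v w → steps v (step (opposite v) ∷ w) ≡ steps v w
steps-opposite up   w = refl
steps-opposite down w = refl

steps-opposite′ : ∀ v w → steps (opposite v) (step v ∷ w) ≡ steps (opposite v) w
steps-opposite′ up   w = refl
steps-opposite′ down w = refl

steps-same′ : ∀ v w → steps (opposite v) (step (opposite v) ∷ w) ≡ suc (steps (opposite v) w)
steps-same′ up   w = refl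
steps-same′ down w = refl

data Relative (v : Dir) : Dir → Set where
  same    : Relative v v
  opposed : Relative v (opposite v)

relative : ∀ v u → Relative v u
relative up   up   = same
relative up   down = opposed
relative down up   = opposed
relative down down = same

motzkin : Dir → RootedA → Word → Word
motzkin v single    k = k
motzkin v (ext d t) k = flat d ∷ motzkin v t k
motzkin v (tri a b) k = step v ∷ motzkin v a (step (opposite v) ∷ motzkin v b k)

excursion : Dir → RootedA → Word → Word
excursion v t k = step v ∷ motzkin v t (step (opposite v) ∷ k)

encode : List 𝓑 → Word
encode []          = []
encode (b₁ ∷ Bs)   = flat fromRoot ∷ encode Bs
encode (b₃ ∷ Bs)   = flat toRoot ∷ encode Bs
encode (b₂ t ∷ Bs) = excursion up t (encode Bs)
encode (b₄ t ∷ Bs) = excursion down t (encode Bs)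

bridge : Dir → RootedA → 𝓑
bridge up   = b₂
bridge down = b₄

Stack : ℕ → Set
Stack h = Vec RootedA (suc h) × List 𝓑

mapTop : ∀ {h} → (RootedA → RootedA) → Stack h → Stack h
mapTop f (t ∷ ts , Bs) = f t ∷ ts , Bs

push : ∀ {h} → Stack h → Stack (suc h)
push (ts , Bs) = single ∷ ts , Bs

graft : ∀ {h} → Stack (suc h) → Stack h
graft (a ∷ b ∷ ts , Bs) = tri a b ∷ ts , Bs

closeExcursion : Dir → Stack 0 → List 𝓑
closeExcursion v (t ∷ [] , Bs) = bridge v t ∷ Bs

unwind : ∀ {n} → Dir → Vec RootedA n → Word → Word
unwind v []       k = k
unwind v (t ∷ ts) k = motzkin v t (step (opposite v) ∷ unwind v ts k)

encodeStack : ∀ {h} → Dir → Stack h → Word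
encodeStack v (ts , Bs) = unwind v ts (encode Bs)

-- decodeStack v h w reads a suffix w left after a prefix that is h + 1 levels deep inside an
-- excursion in direction v.  Such a suffix is encodeStack v (t₀ ∷ … ∷ tₕ , Bs), and
-- decodeStack recovers t₀ … tₕ and Bs; its clause for [] is reached only on unbalanced words.
mutual
  decode : Word → List 𝓑
  decode []                  = []
  decode (flat fromRoot ∷ w) = b₁ ∷ decode w
  decode (flat toRoot ∷ w)   = b₃ ∷ decode w
  decode (step v ∷ w)        = closeExcursion v (decodeStack v 0 w)

  decodeStack : (v : Dir) (h : ℕ) → Word → Stack h
  decodeStack v    h []               = replicate _ single , []
  decodeStack v    h (flat d ∷ w)     = mapTop (ext d) (decodeStack v h w)
  decodeStack up   h (step up ∷ w)    = graft (decodeStack up (suc h) w)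
  decodeStack down h (step down ∷ w)  = graft (decodeStack down (suc h) w)
  decodeStack up   h (step down ∷ w)  = descend up h w
  decodeStack down h (step up ∷ w)    = descend down h w

  descend : (v : Dir) (h : ℕ) → Word → Stack h
  descend v zero    w = single ∷ [] , decode w
  descend v (suc h) w = push (decodeStack v h w)

setTop : ∀ {h} → RootedA → Stack h → Stack h
setTop t = mapTop (λ _ → t)

decodeStack-same : ∀ v h w → decodeStack v h (step v ∷ w) ≡ graft (decodeStack v (suc h) w)
decodeStack-same up   h w = refl
decodeStack-same down h w = refl

decodeStack-opposite : ∀ v h w → decodeStack v h (step (opposite v) ∷ w) ≡ descend v h w
decodeStack-opposite up   h w = refl
decodeStack-opposite down h w = refl

setTop-descend : ∀ v h w → setTop single (descend v h w) ≡ descend v h w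
setTop-descend v zero    w = refl
setTop-descend v (suc h) w = refl

mapTop-setTop : ∀ {h} f t (X : Stack h) → mapTop f (setTop t X) ≡ setTop (f t) X
mapTop-setTop f t (_ ∷ _ , _) = refl

graft-setTop : ∀ {h} a b (X : Stack h) → graft (setTop a (push (setTop b X))) ≡ setTop (tri a b) X
graft-setTop a b (_ ∷ _ , _) = refl

decodeStack-motzkin : ∀ v h t w →
  decodeStack v h (motzkin v t (step (opposite v) ∷ w)) ≡ setTop t (descend v h w)
decodeStack-motzkin v h single w =
  trans (decodeStack-opposite v h w) (sym (setTop-descend v h w))
decodeStack-motzkin v h (ext d t) w =
  trans (cong (mapTop (ext d)) (decodeStack-motzkin v h t w)) (mapTop-setTop (ext d) t _)
decodeStack-motzkin v h (tri a b) w = begin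
  decodeStack v h (step v ∷ motzkin v a (step (opposite v) ∷ motzkin v b k))
    ≡⟨ decodeStack-same v h _ ⟩
  graft (decodeStack v (suc h) (motzkin v a (step (opposite v) ∷ motzkin v b k)))
    ≡⟨ cong graft (decodeStack-motzkin v (suc h) a (motzkin v b k)) ⟩
  graft (setTop a (push (decodeStack v h (motzkin v b k))))
    ≡⟨ cong (λ X → graft (setTop a (push X))) (decodeStack-motzkin v h b w) ⟩
  graft (setTop a (push (setTop b (descend v h w))))
    ≡⟨ graft-setTop a b _ ⟩
  setTop (tri a b) (descend v h w) ∎
  where
  open ≡-Reasoning
  k = step (opposite v) ∷ w

decode-excursion : ∀ v t k → decode (excursion v t k) ≡ bridge v t ∷ decode k
decode-excursion v t k = cong (closeExcursion v) (decodeStack-motzkin v 0 t k)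

decode-encode : ∀ Bs → decode (encode Bs) ≡ Bs
decode-encode []          = refl
decode-encode (b₁ ∷ Bs)   = cong (b₁ ∷_) (decode-encode Bs)
decode-encode (b₃ ∷ Bs)   = cong (b₃ ∷_) (decode-encode Bs)
decode-encode (b₂ t ∷ Bs) = trans (decode-excursion up t _) (cong (b₂ t ∷_) (decode-encode Bs))
decode-encode (b₄ t ∷ Bs) = trans (decode-excursion down t _) (cong (b₄ t ∷_) (decode-encode Bs))

encodeStack-mapTop : ∀ {h} v d (X : Stack h) → encodeStack v (mapTop (ext d) X) ≡ flat d ∷ encodeStack v X
encodeStack-mapTop v d (_ ∷ _ , _) = refl

encodeStack-graft : ∀ {h} v (X : Stack (suc h)) → encodeStack v (graft X) ≡ step v ∷ encodeStack v X
encodeStack-graft v (_ ∷ _ ∷ _ , _) = refl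

encode-closeExcursion : ∀ v X → encode (closeExcursion v X) ≡ step v ∷ encodeStack v X
encode-closeExcursion up   (_ ∷ [] , _) = refl
encode-closeExcursion down (_ ∷ [] , _) = refl

balanced-step : ∀ v w → Balanced (step v ∷ w) → steps (opposite v) w ≡ suc (steps v w)
balanced-step up   w bal = sym bal
balanced-step down w bal = bal

balanced-opposite : ∀ v w → steps (opposite v) w ≡ steps v w → Balanced w
balanced-opposite up   w e = sym e
balanced-opposite down w e = e

mutual
  encode-decode : ∀ w → Balanced w → encode (decode w) ≡ w
  encode-decode []                  _   = refl
  encode-decode (flat fromRoot ∷ w) bal = cong (flat fromRoot ∷_) (encode-decode w bal)
  encode-decode (flat toRoot ∷ w)   bal = cong (flat toRoot ∷_) (encode-decode w bal)
  encode-decode (step v ∷ w)        bal =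
    trans (encode-closeExcursion v (decodeStack v 0 w))
          (cong (step v ∷_) (encodeStack-decodeStack v 0 w (balanced-step v w bal)))

  encodeStack-decodeStack : ∀ v h w → steps (opposite v) w ≡ suc h + steps v w →
                            encodeStack v (decodeStack v h w) ≡ w
  encodeStack-decodeStack v h [] ()
  encodeStack-decodeStack v h (flat d ∷ w) e =
    trans (encodeStack-mapTop v d (decodeStack v h w))
          (cong (flat d ∷_) (encodeStack-decodeStack v h w e))
  encodeStack-decodeStack v h (step u ∷ w) e with relative v u
  ... | same = begin
    encodeStack v (decodeStack v h (step v ∷ w))      ≡⟨ cong (encodeStack v) (decodeStack-same v h w) ⟩
    encodeStack v (graft (decodeStack v (suc h) w))   ≡⟨ encodeStack-graft v (decodeStack v (suc h) w) ⟩
    step v ∷ encodeStack v (decodeStack v (suc h) w)  ≡⟨ cong (step v ∷_) (encodeStack-decodeStack v (suc h) w e′) ⟩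
    step v ∷ w                                        ∎
    where
    open ≡-Reasoning
    e′ : steps (opposite v) w ≡ suc (suc h) + steps v w
    e′ = begin
      steps (opposite v) w                ≡⟨ steps-opposite′ v w ⟨
      steps (opposite v) (step v ∷ w)     ≡⟨ e ⟩
      suc h + steps v (step v ∷ w)        ≡⟨ cong (suc h +_) (steps-same v w) ⟩
      suc h + suc (steps v w)             ≡⟨ +-suc (suc h) (steps v w) ⟩
      suc (suc h) + steps v w             ∎
  ... | opposed = trans (cong (encodeStack v) (decodeStack-opposite v h w)) (encodeStack-descend v h w e′)
    where
    e′ : steps (opposite v) w ≡ h + steps v w
    e′ = suc-injective (begin
      suc (steps (opposite v) w)                    ≡⟨ steps-same′ v w ⟨
      steps (opposite v) (step (opposite v) ∷ w)    ≡⟨ e ⟩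
      suc h + steps v (step (opposite v) ∷ w)       ≡⟨ cong (suc h +_) (steps-opposite v w) ⟩
      suc h + steps v w                             ∎)
      where open ≡-Reasoning

  encodeStack-descend : ∀ v h w → steps (opposite v) w ≡ h + steps v w →
                        encodeStack v (descend v h w) ≡ step (opposite v) ∷ w
  encodeStack-descend v zero    w e = cong (step (opposite v) ∷_) (encode-decode w (balanced-opposite v w e))
  encodeStack-descend v (suc h) w e = cong (step (opposite v) ∷_) (encodeStack-decodeStack v h w e)

length-motzkin : ∀ v t k → suc (length (motzkin v t k)) ≡ verticesA t + length k
length-motzkin v single    k = refl
length-motzkin v (ext d t) k = cong suc (length-motzkin v t k)
length-motzkin v (tri a b) k = cong suc (begin
  suc (length (motzkin v a (step (opposite v) ∷ motzkin v b k))) ≡⟨ length-motzkin v a _ ⟩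
  verticesA a + suc (length (motzkin v b k))                    ≡⟨ cong (verticesA a +_) (length-motzkin v b k) ⟩
  verticesA a + (verticesA b + length k)                        ≡⟨ +-assoc (verticesA a) _ _ ⟨
  verticesA a + verticesA b + length k                          ∎)
  where open ≡-Reasoning

length-excursion : ∀ v t k → length (excursion v t k) ≡ suc (verticesA t + length k)
length-excursion v t k = trans (length-motzkin v t _) (+-suc (verticesA t) (length k))

length-encode : ∀ Bs → length (encode Bs) ≡ excess Bs
length-encode []          = refl
length-encode (b₁ ∷ Bs)   = cong suc (length-encode Bs)
length-encode (b₃ ∷ Bs)   = cong suc (length-encode Bs)
length-encode (b₂ t ∷ Bs) =
  trans (length-excursion up t _) (cong (λ n → suc (verticesA t + n)) (length-encode Bs))
length-encode (b₄ t ∷ Bs) =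
  trans (length-excursion down t _) (cong (λ n → suc (verticesA t + n)) (length-encode Bs))

mutual
  steps-excursion : ∀ u v t k → steps u (excursion v t k) ≡ suc (cyclesA t + steps u k)
  steps-excursion u v t k with relative v u
  ... | same = begin
    steps v (step v ∷ motzkin v t (step (opposite v) ∷ k))  ≡⟨ steps-same v _ ⟩
    suc (steps v (motzkin v t (step (opposite v) ∷ k)))     ≡⟨ cong suc (steps-motzkin v v t _) ⟩
    suc (cyclesA t + steps v (step (opposite v) ∷ k))       ≡⟨ cong (λ n → suc (cyclesA t + n)) (steps-opposite v k) ⟩
    suc (cyclesA t + steps v k)                             ∎
    where open ≡-Reasoning
  ... | opposed = begin
    steps (opposite v) (step v ∷ motzkin v t (step (opposite v) ∷ k))  ≡⟨ steps-opposite′ v _ ⟩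
    steps (opposite v) (motzkin v t (step (opposite v) ∷ k))           ≡⟨ steps-motzkin (opposite v) v t _ ⟩
    cyclesA t + steps (opposite v) (step (opposite v) ∷ k)             ≡⟨ cong (cyclesA t +_) (steps-same′ v k) ⟩
    cyclesA t + suc (steps (opposite v) k)                             ≡⟨ +-suc (cyclesA t) _ ⟩
    suc (cyclesA t + steps (opposite v) k)                             ∎
    where open ≡-Reasoning

  steps-motzkin : ∀ u v t k → steps u (motzkin v t k) ≡ cyclesA t + steps u k
  steps-motzkin u v single    k = refl
  steps-motzkin u v (ext d t) k = steps-motzkin u v t k
  steps-motzkin u v (tri a b) k = begin
    steps u (excursion v a (motzkin v b k))        ≡⟨ steps-excursion u v a _ ⟩
    suc (cyclesA a + steps u (motzkin v b k))      ≡⟨ cong (λ n → suc (cyclesA a + n)) (steps-motzkin u v b k) ⟩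
    suc (cyclesA a + (cyclesA b + steps u k))      ≡⟨ cong suc (+-assoc (cyclesA a) _ _) ⟨
    suc (cyclesA a + cyclesA b + steps u k)        ∎
    where open ≡-Reasoning

steps-encode : ∀ u Bs → steps u (encode Bs) ≡ totalCycles Bs
steps-encode u []          = refl
steps-encode u (b₁ ∷ Bs)   = steps-encode u Bs
steps-encode u (b₃ ∷ Bs)   = steps-encode u Bs
steps-encode u (b₂ t ∷ Bs) =
  trans (steps-excursion u up t _) (cong (λ n → suc (cyclesA t + n)) (steps-encode u Bs))
steps-encode u (b₄ t ∷ Bs) =
  trans (steps-excursion u down t _) (cong (λ n → suc (cyclesA t + n)) (steps-encode u Bs))

𝓑-lists↔balanced-words : ∀ r →
  Σ (List 𝓑) (λ Bs → excess Bs ≡ r) ↔ Σ Word (λ w → length w ≡ r × Balanced w)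
𝓑-lists↔balanced-words r =
  subtype-↔ ≡-irrelevant (×-irrelevant ≡-irrelevant ≡-irrelevant) encode decode
    (λ Bs e → trans (length-encode Bs) e , trans (steps-encode up Bs) (sym (steps-encode down Bs)))
    (λ w (l , bal) → trans (sym (length-encode (decode w))) (trans (cong length (encode-decode w bal)) l))
    (λ Bs _ → decode-encode Bs) (λ w (_ , bal) → encode-decode w bal)

𝓑-lists↔words : ∀ r c →
  Σ (List 𝓑) (λ Bs → excess Bs ≡ r × totalCycles Bs ≡ c) ↔
  Σ Word (λ w → length w ≡ r × (steps up w ≡ c × steps down w ≡ c))
𝓑-lists↔words r c =
  subtype-↔ (×-irrelevant ≡-irrelevant ≡-irrelevant)
            (×-irrelevant ≡-irrelevant (×-irrelevant ≡-irrelevant ≡-irrelevant))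
    encode decode
    (λ Bs (e , t) → trans (length-encode Bs) e , trans (steps-encode up Bs) t , trans (steps-encode down Bs) t)
    (λ w (l , u , d) → let w≡ = encode-decode w (trans u (sym d)) in
      trans (sym (length-encode (decode w))) (trans (cong length w≡) l) ,
      trans (sym (steps-encode up (decode w))) (trans (cong (steps up) w≡) u))
    (λ Bs _ → decode-encode Bs) (λ w (_ , u , d) → encode-decode w (trans u (sym d)))

bitPair : Letter → Bool × Bool
bitPair (flat fromRoot) = true  , false
bitPair (flat toRoot)   = false , true
bitPair (step up)       = true  , true
bitPair (step down)     = false , false

letter : Bool → Bool → Letter
letter true  false = flat fromRoot
letter false true  = flat toRoot
letter true  true  = step up
letter false false = step down

letter-bitPair : ∀ x → letter (proj₁ (bitPair x)) (proj₂ (bitPair x)) ≡ x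
letter-bitPair (flat fromRoot) = refl
letter-bitPair (flat toRoot)   = refl
letter-bitPair (step up)       = refl
letter-bitPair (step down)     = refl

bitPair-letter : ∀ a b → bitPair (letter a b) ≡ (a , b)
bitPair-letter true  false = refl
bitPair-letter false true  = refl
bitPair-letter true  true  = refl
bitPair-letter false false = refl

toBits : Word → List Bool
toBits []      = []
toBits (x ∷ w) = proj₁ (bitPair x) ∷ proj₂ (bitPair x) ∷ toBits w

fromBits : List Bool → Word
fromBits (a ∷ b ∷ bs) = letter a b ∷ fromBits bs
fromBits _            = []

fromBits-toBits : ∀ w → fromBits (toBits w) ≡ w
fromBits-toBits []      = refl
fromBits-toBits (x ∷ w) = cong₂ _∷_ (letter-bitPair x) (fromBits-toBits w)

toBits-fromBits : ∀ n bs → length bs ≡ n + n → toBits (fromBits bs) ≡ bs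
toBits-fromBits n       []           _ = refl
toBits-fromBits zero    (_ ∷ _)      ()
toBits-fromBits (suc n) (_ ∷ [])     e = contradiction (trans (suc-injective e) (+-suc n n)) 0≢1+n
toBits-fromBits (suc n) (a ∷ b ∷ bs) e =
  cong₂ (λ (a , b) bs → a ∷ b ∷ bs) (bitPair-letter a b) (toBits-fromBits n bs length-bs)
  where
  length-bs : length bs ≡ n + n
  length-bs = suc-injective (trans (suc-injective e) (+-suc n n))

length-toBits : ∀ w → length (toBits w) ≡ length w + length w
length-toBits []      = refl
length-toBits (x ∷ w) = cong suc (trans (cong suc (length-toBits w)) (sym (+-suc (length w) (length w))))

trues-toBits : ∀ w → trues (toBits w) + steps down w ≡ length w + steps up w
trues-toBits []                  = refl
trues-toBits (flat fromRoot ∷ w) = cong suc (trues-toBits w)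
trues-toBits (flat toRoot ∷ w)   = cong suc (trues-toBits w)
trues-toBits (step up ∷ w)       = cong suc (trans (cong suc (trues-toBits w)) (sym (+-suc (length w) _)))
trues-toBits (step down ∷ w)     = trans (+-suc (trues (toBits w)) _) (cong suc (trues-toBits w))

balanced↔BitString : ∀ r → Σ Word (λ w → length w ≡ r × Balanced w) ↔ BitString (r + r) r
balanced↔BitString r =
  subtype-↔ (×-irrelevant ≡-irrelevant ≡-irrelevant) (×-irrelevant ≡-irrelevant ≡-irrelevant)
    toBits fromBits toBits-resp fromBits-resp
    (λ w _ → fromBits-toBits w) (λ bs (l , _) → toBits-fromBits r bs l)
  where
  toBits-resp : ∀ w → length w ≡ r × Balanced w → IsBitString (r + r) r (toBits w)
  toBits-resp w (l , bal) =
    trans (length-toBits w) (cong₂ _+_ l l) ,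
    trans (+-cancelʳ-≡ (steps down w) _ _ (trans (trues-toBits w) (cong (length w +_) bal))) l
  fromBits-resp : ∀ bs → IsBitString (r + r) r bs → length (fromBits bs) ≡ r × Balanced (fromBits bs)
  fromBits-resp bs (l , t) = length-w , sym (+-cancelˡ-≡ (length w) _ _ (begin
    length w + steps down w            ≡⟨ cong (_+ steps down w) (trans length-w (sym t)) ⟩
    trues bs + steps down w            ≡⟨ cong (λ bs → trues bs + steps down w) w-bits ⟨
    trues (toBits w) + steps down w    ≡⟨ trues-toBits w ⟩
    length w + steps up w              ∎))
    where
    open ≡-Reasoning
    w = fromBits bs
    w-bits : toBits w ≡ bs
    w-bits = toBits-fromBits r bs l
    length-w : length w ≡ r
    length-w = m+m≡n+n⇒m≡n (trans (sym (length-toBits w)) (trans (cong length w-bits) l))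

stepMask : Word → List Bool
stepMask []           = []
stepMask (flat _ ∷ w) = false ∷ stepMask w
stepMask (step _ ∷ w) = true ∷ stepMask w

upMask : Word → List Bool
upMask []              = []
upMask (flat _ ∷ w)    = upMask w
upMask (step up ∷ w)   = true ∷ upMask w
upMask (step down ∷ w) = false ∷ upMask w

flats : Word → List ArrowDir
flats []           = []
flats (flat d ∷ w) = d ∷ flats w
flats (step _ ∷ w) = flats w

interleave : List Bool → List Bool → List ArrowDir → Word
interleave (false ∷ m) us           (d ∷ ds) = flat d ∷ interleave m us ds
interleave (true ∷ m)  (true ∷ us)  ds       = step up ∷ interleave m us ds
interleave (true ∷ m)  (false ∷ us) ds       = step down ∷ interleave m us ds
interleave _           _            _        = []

unzip₃ : Word → List Bool × List Bool × List ArrowDir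
unzip₃ w = stepMask w , upMask w , flats w

interleave-unzip₃ : ∀ w → interleave (stepMask w) (upMask w) (flats w) ≡ w
interleave-unzip₃ []              = refl
interleave-unzip₃ (flat d ∷ w)    = cong (flat d ∷_) (interleave-unzip₃ w)
interleave-unzip₃ (step up ∷ w)   = cong (step up ∷_) (interleave-unzip₃ w)
interleave-unzip₃ (step down ∷ w) = cong (step down ∷_) (interleave-unzip₃ w)

unzip₃-interleave : ∀ m us ds → length us ≡ trues m → length ds ≡ falses m →
                    unzip₃ (interleave m us ds) ≡ (m , us , ds)
unzip₃-interleave []          []           []       _  _  = refl
unzip₃-interleave (false ∷ m) us           (d ∷ ds) eu ed =
  cong (λ (m , us , ds) → false ∷ m , us , d ∷ ds) (unzip₃-interleave m us ds eu (suc-injective ed))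
unzip₃-interleave (true ∷ m)  (true ∷ us)  ds       eu ed =
  cong (λ (m , us , ds) → true ∷ m , true ∷ us , ds) (unzip₃-interleave m us ds (suc-injective eu) ed)
unzip₃-interleave (true ∷ m)  (false ∷ us) ds       eu ed =
  cong (λ (m , us , ds) → true ∷ m , false ∷ us , ds) (unzip₃-interleave m us ds (suc-injective eu) ed)

length-stepMask : ∀ w → length (stepMask w) ≡ length w
length-stepMask []           = refl
length-stepMask (flat _ ∷ w) = cong suc (length-stepMask w)
length-stepMask (step _ ∷ w) = cong suc (length-stepMask w)

trues-stepMask : ∀ w → trues (stepMask w) ≡ steps up w + steps down w
trues-stepMask []              = refl
trues-stepMask (flat _ ∷ w)    = trues-stepMask w
trues-stepMask (step up ∷ w)   = cong suc (trues-stepMask w)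
trues-stepMask (step down ∷ w) = trans (cong suc (trues-stepMask w)) (sym (+-suc (steps up w) _))

falses-stepMask : ∀ w → falses (stepMask w) ≡ length (flats w)
falses-stepMask []           = refl
falses-stepMask (flat _ ∷ w) = cong suc (falses-stepMask w)
falses-stepMask (step _ ∷ w) = falses-stepMask w

length-upMask : ∀ w → length (upMask w) ≡ steps up w + steps down w
length-upMask []              = refl
length-upMask (flat _ ∷ w)    = length-upMask w
length-upMask (step up ∷ w)   = cong suc (length-upMask w)
length-upMask (step down ∷ w) = trans (cong suc (length-upMask w)) (sym (+-suc (steps up w) _))

trues-upMask : ∀ w → trues (upMask w) ≡ steps up w
trues-upMask []              = refl
trues-upMask (flat _ ∷ w)    = trues-upMask w
trues-upMask (step up ∷ w)   = cong suc (trues-upMask w)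
trues-upMask (step down ∷ w) = trues-upMask w

Riffle : ℕ → ℕ → List Bool × List Bool × List ArrowDir → Set
Riffle r c (m , us , ds) = IsBitString r (c + c) m × IsBitString (c + c) c us × length ds ≡ r ∸ (c + c)

words↔riffles : ∀ r c →
  Σ Word (λ w → length w ≡ r × (steps up w ≡ c × steps down w ≡ c)) ↔
  Σ (List Bool × List Bool × List ArrowDir) (Riffle r c)
words↔riffles r c =
  subtype-↔ (×-irrelevant ≡-irrelevant (×-irrelevant ≡-irrelevant ≡-irrelevant))
            (×-irrelevant (×-irrelevant ≡-irrelevant ≡-irrelevant)
              (×-irrelevant (×-irrelevant ≡-irrelevant ≡-irrelevant) ≡-irrelevant))
    unzip₃ (λ (m , us , ds) → interleave m us ds) unzip₃-resp interleave-resp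
    (λ w _ → interleave-unzip₃ w)
    (λ (m , us , ds) q → unzip₃-interleave m us ds (us-length m us ds q) (ds-length m us ds q))
  where
  falses≡ : ∀ m → length m ≡ r → trues m ≡ c + c → falses m ≡ r ∸ (c + c)
  falses≡ m l t = trans (falses≡length∸trues m) (cong₂ _∸_ l t)

  us-length : ∀ m us ds → Riffle r c (m , us , ds) → length us ≡ trues m
  us-length m us ds ((_ , tm) , (lus , _) , _) = trans lus (sym tm)

  ds-length : ∀ m us ds → Riffle r c (m , us , ds) → length ds ≡ falses m
  ds-length m us ds ((lm , tm) , _ , lds) = trans lds (sym (falses≡ m lm tm))

  unzip₃-resp : ∀ w → length w ≡ r × (steps up w ≡ c × steps down w ≡ c) → Riffle r c (unzip₃ w)
  unzip₃-resp w (l , u , d) =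
    (length-stepMask′ , trues-stepMask′) ,
    (trans (length-upMask w) (cong₂ _+_ u d) , trans (trues-upMask w) u) ,
    trans (sym (falses-stepMask w)) (falses≡ (stepMask w) length-stepMask′ trues-stepMask′)
    where
    length-stepMask′ = trans (length-stepMask w) l
    trues-stepMask′  = trans (trues-stepMask w) (cong₂ _+_ u d)

  interleave-resp : ∀ x → Riffle r c x →
    let w = interleave (proj₁ x) (proj₁ (proj₂ x)) (proj₂ (proj₂ x))
    in length w ≡ r × (steps up w ≡ c × steps down w ≡ c)
  interleave-resp (m , us , ds) q@((lm , tm) , (_ , tus) , _) =
    trans (sym (length-stepMask w)) (trans (cong length mask) lm) , ups , downs
    where
    w = interleave m us ds
    unzipped = unzip₃-interleave m us ds (us-length m us ds q) (ds-length m us ds q)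
    mask : stepMask w ≡ m
    mask = cong proj₁ unzipped
    ups : steps up w ≡ c
    ups = trans (sym (trues-upMask w)) (trans (cong (λ x → trues (proj₁ (proj₂ x))) unzipped) tus)
    downs : steps down w ≡ c
    downs = +-cancelˡ-≡ c _ _ (begin
      c + steps down w              ≡⟨ cong (_+ steps down w) ups ⟨
      steps up w + steps down w     ≡⟨ trues-stepMask w ⟨
      trues (stepMask w)            ≡⟨ cong trues mask ⟩
      trues m                       ≡⟨ tm ⟩
      c + c                         ∎)
      where open ≡-Reasoning

ArrowDir↔Fin2 : ArrowDir ↔ Fin 2
ArrowDir↔Fin2 = mk↔ₛ′ (λ { fromRoot → 0F ; toRoot → 1F }) (λ { 0F → fromRoot ; 1F → toRoot })
                      (λ { 0F → refl ; 1F → refl }) (λ { fromRoot → refl ; toRoot → refl })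

𝓑-lists↔Fin-central-binomial : ∀ r → Σ (List 𝓑) (λ Bs → excess Bs ≡ r) ↔ Fin ((2 * r) C r)
𝓑-lists↔Fin-central-binomial r = begin
  Σ (List 𝓑) (λ Bs → excess Bs ≡ r)           ↔⟨ 𝓑-lists↔balanced-words r ⟩
  Σ Word (λ w → length w ≡ r × Balanced w)     ↔⟨ balanced↔BitString r ⟩
  BitString (r + r) r                          ↔⟨ BitString↔Fin-C (r + r) r ⟩
  Fin ((r + r) C r)                            ↔⟨ ≡⇒Fin↔ (cong (_C r) (2*n≡n+n r)) ⟨
  Fin ((2 * r) C r)                            ∎
  where open EquationalReasoning

riffle-count : ∀ r c →
  (r C (c + c)) * (((c + c) C c) * 2 ^ (r ∸ (c + c))) ≡ 2 ^ (r ∸ 2 * c) * multinomial3 r c c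
riffle-count r c = begin
  (r C (c + c)) * (((c + c) C c) * 2 ^ (r ∸ (c + c)))  ≡⟨ *-assoc (r C (c + c)) _ _ ⟨
  (r C (c + c)) * ((c + c) C c) * 2 ^ (r ∸ (c + c))    ≡⟨ *-comm _ (2 ^ (r ∸ (c + c))) ⟩
  2 ^ (r ∸ (c + c)) * ((r C (c + c)) * ((c + c) C c))  ≡⟨ cong₂ (λ k m → 2 ^ (r ∸ k) * m) (2*n≡n+n c) (multinomial3≡C*C r c c) ⟨
  2 ^ (r ∸ 2 * c) * multinomial3 r c c                 ∎
  where open ≡-Reasoning

𝓑-lists↔Fin-cycles : ∀ r c →
  Σ (List 𝓑) (λ Bs → excess Bs ≡ r × totalCycles Bs ≡ c) ↔ Fin (2 ^ (r ∸ 2 * c) * multinomial3 r c c)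
𝓑-lists↔Fin-cycles r c = begin
  Σ (List 𝓑) (λ Bs → excess Bs ≡ r × totalCycles Bs ≡ c)
    ↔⟨ 𝓑-lists↔words r c ⟩
  Σ Word (λ w → length w ≡ r × (steps up w ≡ c × steps down w ≡ c))
    ↔⟨ words↔riffles r c ⟩
  Σ (List Bool × List Bool × List ArrowDir) (Riffle r c)
    ↔⟨ Σ-×↔×-Σ {P = IsBitString r (c + c)} ⟩
  (BitString r (c + c) ×
   Σ (List Bool × List ArrowDir) (λ (us , ds) → IsBitString (c + c) c us × length ds ≡ r ∸ (c + c)))
    ↔⟨ ↔-refl ×-↔ Σ-×↔×-Σ ⟩
  (BitString r (c + c) × BitString (c + c) c × Tuples ArrowDir (r ∸ (c + c)))
    ↔⟨ BitString↔Fin-C r (c + c)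
         ×-↔ (BitString↔Fin-C (c + c) c ×-↔ Tuples↔Fin^ ArrowDir↔Fin2 (r ∸ (c + c))) ⟩
  (Fin (r C (c + c)) × Fin ((c + c) C c) × Fin (2 ^ (r ∸ (c + c))))
    ↔⟨ ↔-refl ×-↔ *↔× ⟨
  (Fin (r C (c + c)) × Fin (((c + c) C c) * 2 ^ (r ∸ (c + c))))
    ↔⟨ *↔× ⟨
  Fin ((r C (c + c)) * (((c + c) C c) * 2 ^ (r ∸ (c + c))))
    ↔⟨ ≡⇒Fin↔ (riffle-count r c) ⟩
  Fin (2 ^ (r ∸ 2 * c) * multinomial3 r c c)
    ∎
  where
  open EquationalReasoning

multinomial3-central : ∀ r c →
  2 ^ (r ∸ 2 * c) * multinomial3 r c c ≡ 2 ^ (r ∸ 2 * c) * (r C (2 * c)) * ((2 * c) C c)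
multinomial3-central r c = begin
  p * multinomial3 r c c               ≡⟨ cong (p *_) (multinomial3≡C*C r c c) ⟩
  p * ((r C (c + c)) * ((c + c) C c))  ≡⟨ cong (λ k → p * ((r C k) * (k C c))) (2*n≡n+n c) ⟨
  p * ((r C (2 * c)) * ((2 * c) C c))  ≡⟨ *-assoc p _ _ ⟨
  p * (r C (2 * c)) * ((2 * c) C c)    ∎
  where
  open ≡-Reasoning
  p = 2 ^ (r ∸ 2 * c)

lemma3p7 : (r : ℕ)
    → (Σ (List 𝓑) (λ Bs → excess Bs ≡ r) ↔ Fin ((2 * r) C r))
      × ((r₂ : ℕ)
         → (Σ (List 𝓑) (λ Bs → excess Bs ≡ r × totalCycles Bs ≡ r₂)
              ↔ Fin (2 ^ (r ∸ 2 * r₂) * multinomial3 r r₂ r₂))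
           × (2 ^ (r ∸ 2 * r₂) * multinomial3 r r₂ r₂
              ≡ 2 ^ (r ∸ 2 * r₂) * (r C (2 * r₂)) * ((2 * r₂) C r₂)))
lemma3p7 r = 𝓑-lists↔Fin-central-binomial r , λ r₂ → 𝓑-lists↔Fin-cycles r r₂ , multinomial3-central r r₂
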